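{- Let a group $G$ act on a set $U$, and let $\mathcal{F}$ be a $G$-invariant family of finite subsets of $U$ whose cardinalities are bounded. Let $X\subseteq U$ be a finite system of representatives for $\mathcal{F}$ (i.e. $X\cap F\neq\varnothing$ for all $F\in\mathcal{F}$) of minimum possible cardinality among all finite systems of representatives. Suppose the $G$-orbits in $U$ having nonempty intersection with $X$ are exactly $V_1,\dots,V_n$. Then: 0) $|V_i|<\infty$ for all $i$. Moreover, if there exists a $G$-invariant system of representatives $Y$ for $\mathcal{F}$ of minimum cardinality among all $G$-invariant systems of representatives such that $|Y|=|X|\cdot\max_{F\in\mathcal{F}}|F|$, then: 1) for every $i$, $|V_i|=\max_{F\in\mathcal{F}}|F|\cdot|X\cap V_i|$; 2) $\bigcup_{F\in\mathcal{F}}F\subseteq\bigcup_{i=1}^n V_i$; 3) for every $i$ there exists $F\in\mathcal{F}$ with $F\subseteq V_i$.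
   Context: A family $\mathcal{F}$ of subsets of $U$ is simply a set of subsets. $\mathcal{F}$ is $G$-invariant if $gF=\{gf\mid f\in F\}\in\mathcal{F}$ for all $g\in G$, $F\in\mathcal{F}$. A subset $Y\subseteq U$ is $G$-invariant if $gY=Y$ for all $g\in G$. Orbits are orbits of the action of $G$ on $U$. -}

module Defs where

open import Level using (0ℓ)
open import Algebra.Bundles using (Group)
open import Data.Nat using (ℕ; _≤_; _*_)
open import Data.Fin using (Fin)
open import Data.List using (List; length)
open import Data.List.Membership.Propositional using (_∈_)
open import Data.List.Relation.Unary.Unique.Propositional using (Unique)
open import Data.Product using (Σ; ∃; ∃-syntax; _×_; _,_)
open import Function.Bundles using (_⇔_)
open import Relation.Binary.PropositionalEquality using (_≡_)
open import Relation.Unary using (Pred; _⊆_; _∩_)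

record Action (G : Group 0ℓ 0ℓ) (U : Set) : Set where
  open Group G
  field
    act      : Carrier → U → U
    act-ε    : ∀ u → act ε u ≡ u
    act-∙    : ∀ g h u → act (g ∙ h) u ≡ act g (act h u)
    act-cong : ∀ {g h} → g ≈ h → ∀ u → act g u ≡ act h u

module _ {G : Group 0ℓ 0ℓ} {U : Set} (A : Action G U) where
  open Group G using (Carrier)
  open Action A

  image : Carrier → Pred U 0ℓ → Pred U 0ℓ
  image g S u = ∃[ s ] (S s × act g s ≡ u)

  InvariantSet : Pred U 0ℓ → Set
  InvariantSet Y = ∀ g u → image g Y u ⇔ Y u

  InvariantFamily : {I : Set} → (I → Pred U 0ℓ) → Set
  InvariantFamily {I} F = ∀ g i → ∃[ j ] (∀ u → F j u ⇔ image g (F i) u)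

  IsOrbit : Pred U 0ℓ → Set
  IsOrbit V = ∃[ u ] (∀ w → V w ⇔ (∃[ g ] act g u ≡ w))

HasCard : {U : Set} → Pred U 0ℓ → ℕ → Set
HasCard {U} S n = Σ (List U) λ xs → Unique xs × length xs ≡ n × (∀ u → S u ⇔ (u ∈ xs))

Finite : {U : Set} → Pred U 0ℓ → Set
Finite S = ∃[ n ] HasCard S n

IsSR : {U I : Set} → (I → Pred U 0ℓ) → Pred U 0ℓ → Set
IsSR F X = ∀ i → ∃[ u ] (X u × F i u)

IsMaxCard : {U I : Set} → (I → Pred U 0ℓ) → ℕ → Set
IsMaxCard F m = (∃[ i ] HasCard (F i) m) × (∀ i k → HasCard (F i) k → k ≤ m)

-- A point of X with infinite orbit can be dropped: by B. H. Neumann's lemma some g fixes the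
-- finite-orbit points of a member F while moving all its other points off the finite set X, and
-- gF ∈ 𝓕 must still meet X.  So a minimum X lies in finitely many finite orbits V₁, …, Vₙ.
-- For a member F, count the translates of the tuple (p₁, …, p_r) listing F ∩ ⋃ⱼ Vⱼ: the q-th
-- coordinate runs over the orbit of p_q, hitting each point φ_q times, and every translate meets X.
-- Hence Σ_q |orbit p_q| φ_q = r T ≤ m T ≤ m Σ_q |X ∩ orbit p_q| φ_q, so F meets an orbit with
-- |Vⱼ| ≤ m |X ∩ Vⱼ|.  The union of these orbits is an invariant system of representatives with at
-- most Σⱼ m |X ∩ Vⱼ| = k m points; the lower bound k m therefore forces |Vⱼ| = m |X ∩ Vⱼ| for all j.
-- Then the counting is tight, which puts every member inside ⋃ⱼ Vⱼ, and removing one orbit Vⱼ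
-- would leave a smaller invariant system of representatives unless some member lies in Vⱼ.

module Submission where

open import Defs
open import Level using (0ℓ)
open import Algebra.Bundles using (Group)
open import Axiom.ExcludedMiddle using (ExcludedMiddle)
open import Data.Empty using (⊥; ⊥-elim)
open import Data.Fin as Fin using (Fin)
open import Data.Fin.Properties using (any?)
open import Data.List as List
  using (List; []; _∷_; length; map; _++_; filter; deduplicate; cartesianProductWith; concatMap; allFin)
open import Data.List.Properties using (length-map; length-tabulate)
open import Data.List.Membership.Propositional using (_∈_; _∉_; lose)
open import Data.List.Membership.Propositional.Properties
  using ( ∈-filter⁺; ∈-filter⁻; ∈-deduplicate⁺; ∈-deduplicate⁻; ∈-cartesianProductWith⁺
        ; ∈-cartesianProductWith⁻; ∈-map⁺; ∈-map⁻; ∈-++⁺ˡ; ∈-++⁺ʳ; ∈-++⁻; ∈-allFin; ∈-lookup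
        ; ∈-concatMap⁺)
import Data.List.Relation.Binary.Subset.Propositional as ListSubset
open import Data.List.Relation.Unary.All as All using ()
open import Data.List.Relation.Unary.AllPairs using ([]; _∷_)
open import Data.List.Relation.Unary.Any as Any using (here; there)
open import Data.List.Relation.Unary.Any.Properties using (lookup-index)
open import Data.List.Relation.Unary.Unique.Propositional using (Unique)
open import Data.List.Relation.Unary.Unique.Propositional.Properties using (filter⁺; map⁺; allFin⁺)
import Data.List.Relation.Unary.Unique.DecPropositional.Properties as UniqueDec
open import Data.Nat using (ℕ; suc; _+_; _*_; _≤_; _<_; z≤n; s≤s; >-nonZero)
open import Data.Nat.Properties hiding (_≟_)
open import Algebra.Properties.CommutativeSemigroup +-commutativeSemigroup using (interchange)
open import Data.Product using (∃-syntax; _×_; _,_; proj₁; proj₂; map₂; swap)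
open import Data.Sum using (inj₁; inj₂)
open import Data.Vec as Vec using (Vec; []; _∷_; lookup)
open import Data.Vec.Properties using (lookup-map; map-∘; map-cong; map-id; lookup∘tabulate)
open import Function using (id; _∘_)
open import Function.Bundles using (_⇔_; mk⇔; Equivalence)
open import Relation.Binary.Definitions using (DecidableEquality)
open import Relation.Binary.PropositionalEquality
open import Relation.Nullary using (¬_; yes; no)
open import Relation.Nullary.Decidable using (decidable-stable)
open import Relation.Unary using (Pred; _⊆_; _∩_; _≐_)

open Equivalence using (to; from)

module _ {A : Set} where

  ∑ : List A → (A → ℕ) → ℕ
  ∑ []       f = 0
  ∑ (x ∷ xs) f = f x + ∑ xs f

  infix 5 ∑
  syntax ∑ xs (λ x → e) = ∑[ x ∈ xs ] e

  ∑-cong : ∀ xs {f g : A → ℕ} → (∀ {x} → x ∈ xs → f x ≡ g x) → ∑ xs f ≡ ∑ xs g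
  ∑-cong []       eq = refl
  ∑-cong (x ∷ xs) eq = cong₂ _+_ (eq (here refl)) (∑-cong xs (eq ∘ there))

  ∑-mono-≤ : ∀ xs {f g : A → ℕ} → (∀ {x} → x ∈ xs → f x ≤ g x) → ∑ xs f ≤ ∑ xs g
  ∑-mono-≤ []       le = z≤n
  ∑-mono-≤ (x ∷ xs) le = +-mono-≤ (le (here refl)) (∑-mono-≤ xs (le ∘ there))

  ∑-mono-< : ∀ {xs x₀} {f g : A → ℕ} → x₀ ∈ xs → (∀ {x} → x ∈ xs → f x < g x) → ∑ xs f < ∑ xs g
  ∑-mono-< {y ∷ ys} _ lt = +-mono-<-≤ (lt (here refl)) (∑-mono-≤ ys (<⇒≤ ∘ lt ∘ there))

  ∑-positive⇒∈ : ∀ {xs} {f : A → ℕ} → 1 ≤ ∑ xs f → ∃[ x ] x ∈ xs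
  ∑-positive⇒∈ {x ∷ _} _ = x , here refl

  ∑-const : ∀ xs c → ∑[ _ ∈ xs ] c ≡ length xs * c
  ∑-const []       c = refl
  ∑-const (x ∷ xs) c = cong (c +_) (∑-const xs c)

  ∑-*ˡ : ∀ xs c (f : A → ℕ) → ∑[ x ∈ xs ] c * f x ≡ c * ∑ xs f
  ∑-*ˡ []       c f = sym (*-zeroʳ c)
  ∑-*ˡ (x ∷ xs) c f = trans (cong (c * f x +_) (∑-*ˡ xs c f)) (sym (*-distribˡ-+ c (f x) (∑ xs f)))

  ∑-*ʳ : ∀ xs (f : A → ℕ) c → ∑[ x ∈ xs ] f x * c ≡ ∑ xs f * c
  ∑-*ʳ []       f c = refl
  ∑-*ʳ (x ∷ xs) f c = trans (cong (f x * c +_) (∑-*ʳ xs f c)) (sym (*-distribʳ-+ c (f x) (∑ xs f)))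

  ∑-+ : ∀ xs (f g : A → ℕ) → ∑[ x ∈ xs ] (f x + g x) ≡ ∑ xs f + ∑ xs g
  ∑-+ []       f g = refl
  ∑-+ (x ∷ xs) f g = trans (cong (f x + g x +_) (∑-+ xs f g)) (interchange (f x) (g x) (∑ xs f) (∑ xs g))

  ∑-tight : ∀ xs {f g : A → ℕ} → (∀ {x} → x ∈ xs → f x ≤ g x) → ∑ xs g ≤ ∑ xs f →
            ∀ {x} → x ∈ xs → f x ≡ g x
  ∑-tight (y ∷ xs) {f} {g} le ge (here refl) =
    ≤-antisym (le (here refl)) (+-cancelʳ-≤ (∑ xs g) (g y) (f y)
      (≤-trans ge (+-monoʳ-≤ (f y) (∑-mono-≤ xs (le ∘ there)))))
  ∑-tight (y ∷ xs) {f} {g} le ge (there p) =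
    ∑-tight xs (le ∘ there) (+-cancelˡ-≤ (g y) (∑ xs g) (∑ xs f)
      (≤-trans ge (+-monoˡ-≤ (∑ xs f) (le (here refl))))) p

  ∑-1 : ∀ (xs : List A) → ∑[ _ ∈ xs ] 1 ≡ length xs
  ∑-1 xs = trans (∑-const xs 1) (*-identityʳ (length xs))

  ∈⇒1≤length : ∀ {xs : List A} {x} → x ∈ xs → 1 ≤ length xs
  ∈⇒1≤length (here _)  = s≤s z≤n
  ∈⇒1≤length (there _) = s≤s z≤n

∑-swap : ∀ {A B : Set} xs ys (f : A → B → ℕ) →
         ∑[ x ∈ xs ] ∑[ y ∈ ys ] f x y ≡ ∑[ y ∈ ys ] ∑[ x ∈ xs ] f x y
∑-swap []       ys f = sym (trans (∑-const ys 0) (*-zeroʳ (length ys)))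
∑-swap (x ∷ xs) ys f = trans (cong (∑ ys (f x) +_) (∑-swap xs ys f))
                             (sym (∑-+ ys (f x) (λ y → ∑[ x′ ∈ xs ] f x′ y)))

module WeightedCounts {r : ℕ} {c a φ : Fin r → ℕ} {T : ℕ}
  (1≤T : 1 ≤ T) (c*φ≡T : ∀ q → c q * φ q ≡ T) (T≤∑a*φ : T ≤ ∑[ q ∈ allFin r ] a q * φ q) where

  φ-positive : ∀ q → 1 ≤ φ q
  φ-positive q = n≢0⇒n>0 λ φq≡0 →
    <⇒≢ 1≤T (sym (trans (sym (c*φ≡T q)) (trans (cong (c q *_) φq≡0) (*-zeroʳ (c q)))))

  ∑c*φ≡r*T : ∑[ q ∈ allFin r ] c q * φ q ≡ r * T
  ∑c*φ≡r*T = begin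
    ∑[ q ∈ allFin r ] c q * φ q  ≡⟨ ∑-cong (allFin r) (λ {q} _ → c*φ≡T q) ⟩
    ∑[ q ∈ allFin r ] T          ≡⟨ ∑-const (allFin r) T ⟩
    length (allFin r) * T        ≡⟨ cong (_* T) (length-tabulate {n = r} id) ⟩
    r * T                        ∎
    where open ≡-Reasoning

  m*T≤∑m*a*φ : ∀ m → m * T ≤ ∑[ q ∈ allFin r ] m * a q * φ q
  m*T≤∑m*a*φ m = begin
    m * T                                ≤⟨ *-monoʳ-≤ m T≤∑a*φ ⟩
    m * (∑[ q ∈ allFin r ] a q * φ q)    ≡⟨ sym (∑-*ˡ (allFin r) m _) ⟩
    ∑[ q ∈ allFin r ] m * (a q * φ q)    ≡⟨ ∑-cong (allFin r) (λ {q} _ → sym (*-assoc m (a q) (φ q))) ⟩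
    ∑[ q ∈ allFin r ] m * a q * φ q      ∎
    where open ≤-Reasoning

  ∃c≤m*a : ∀ {m} → r ≤ m → ∃[ q ] c q ≤ m * a q
  ∃c≤m*a {m} r≤m with any? (λ q → c q ≤? m * a q)
  ... | yes found = found
  ... | no  none  = ⊥-elim (<-irrefl refl (begin-strict
    ∑[ q ∈ allFin r ] m * a q * φ q   <⟨ ∑-mono-< (proj₂ (∑-positive⇒∈ (≤-trans 1≤T T≤∑a*φ))) m*a*φ<c*φ ⟩
    ∑[ q ∈ allFin r ] c q * φ q       ≡⟨ ∑c*φ≡r*T ⟩
    r * T                             ≤⟨ *-monoˡ-≤ T r≤m ⟩
    m * T                             ≤⟨ m*T≤∑m*a*φ m ⟩
    ∑[ q ∈ allFin r ] m * a q * φ q   ∎))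
    where
    open ≤-Reasoning
    m*a*φ<c*φ : ∀ {q} → q ∈ allFin r → m * a q * φ q < c q * φ q
    m*a*φ<c*φ {q} _ = *-monoˡ-< (φ q) {{>-nonZero (φ-positive q)}} (≰⇒> (none ∘ (q ,_)))

  m≤r : ∀ {m} → (∀ q → c q ≡ m * a q) → m ≤ r
  m≤r {m} c≡m*a = *-cancelʳ-≤ m r T {{>-nonZero 1≤T}} (begin
    m * T                             ≤⟨ m*T≤∑m*a*φ m ⟩
    ∑[ q ∈ allFin r ] m * a q * φ q   ≡⟨ ∑-cong (allFin r) (λ {q} _ → cong (_* φ q) (sym (c≡m*a q))) ⟩
    ∑[ q ∈ allFin r ] c q * φ q       ≡⟨ ∑c*φ≡r*T ⟩
    r * T                             ∎)
    where open ≤-Reasoning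

module FiniteCounting (em : ExcludedMiddle 0ℓ) where

  𝟙 : Set → ℕ
  𝟙 P with em {P}
  ... | yes _ = 1
  ... | no  _ = 0

  𝟙-yes : {P : Set} → P → 𝟙 P ≡ 1
  𝟙-yes {P} p with em {P}
  ... | yes _ = refl
  ... | no ¬p = ⊥-elim (¬p p)

  𝟙-no : {P : Set} → ¬ P → 𝟙 P ≡ 0
  𝟙-no {P} ¬p with em {P}
  ... | yes p = ⊥-elim (¬p p)
  ... | no _  = refl

  𝟙≤1 : (P : Set) → 𝟙 P ≤ 1
  𝟙≤1 P with em {P}
  ... | yes _ = ≤-refl
  ... | no  _ = z≤n

  𝟙*x≡y⇒x≡y : ∀ {P x y} → 1 ≤ y → 𝟙 P * x ≡ y → x ≡ y
  𝟙*x≡y⇒x≡y {P} {x} 1≤y eq with em {P}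
  ... | yes _ = trans (sym (+-identityʳ x)) eq
  ... | no  _ = ⊥-elim (<⇒≢ 1≤y eq)

  module _ {A : Set} where

    count : Pred A 0ℓ → List A → ℕ
    count P xs = ∑[ x ∈ xs ] 𝟙 (P x)

    filterᶜ : Pred A 0ℓ → List A → List A
    filterᶜ P = filter {P = P} (λ _ → em)

    ∈-filterᶜ⁺ : ∀ P {xs x} → x ∈ xs → P x → x ∈ filterᶜ P xs
    ∈-filterᶜ⁺ P = ∈-filter⁺ (λ _ → em)

    ∈-filterᶜ⁻ : ∀ P xs {x} → x ∈ filterᶜ P xs → x ∈ xs × P x
    ∈-filterᶜ⁻ P xs = ∈-filter⁻ (λ _ → em) {xs = xs}

    length-filterᶜ : ∀ P xs → length (filterᶜ P xs) ≡ count P xs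
    length-filterᶜ P []       = refl
    length-filterᶜ P (x ∷ xs) with em {P x}
    ... | yes _ = cong suc (length-filterᶜ P xs)
    ... | no  _ = length-filterᶜ P xs

    count≤length : ∀ P xs → count P xs ≤ length xs
    count≤length P []       = z≤n
    count≤length P (x ∷ xs) = +-mono-≤ (𝟙≤1 (P x)) (count≤length P xs)

    count<length : ∀ P {xs x} → x ∈ xs → ¬ P x → count P xs < length xs
    count<length P {x ∷ xs} (here refl) ¬px rewrite 𝟙-no ¬px = s≤s (count≤length P xs)
    count<length P {y ∷ xs} (there p)   ¬px = +-mono-≤-< (𝟙≤1 (P y)) (count<length P p ¬px)

    length≤count⇒∈⇒P : ∀ P xs → length xs ≤ count P xs → ∀ {x} → x ∈ xs → P x
    length≤count⇒∈⇒P P xs le {x} x∈xs with em {P x}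
    ... | yes px  = px
    ... | no  ¬px = ⊥-elim (<⇒≱ (count<length P x∈xs ¬px) le)

    1≤count : ∀ P {xs x} → x ∈ xs → P x → 1 ≤ count P xs
    1≤count P {x ∷ xs} (here refl) px rewrite 𝟙-yes px = s≤s z≤n
    1≤count P {y ∷ xs} (there p)   px = ≤-trans (1≤count P p px) (m≤n+m _ _)

    ∑-𝟙-single : ∀ {P : Pred A 0ℓ} {vs k} (w : A → ℕ) → Unique vs → k ∈ vs → P k →
                 (∀ {v} → P v → v ≡ k) → ∑[ v ∈ vs ] w v * 𝟙 (P v) ≡ w k
    ∑-𝟙-single {P} {v ∷ vs} w (v∉vs ∷ !vs) (here refl) pv uniq rewrite 𝟙-yes pv =
      trans (cong₂ _+_ (*-identityʳ (w v)) rest≡0) (+-identityʳ (w v))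
      where
      rest≡0 : ∑[ u ∈ vs ] w u * 𝟙 (P u) ≡ 0
      rest≡0 = begin
        ∑[ u ∈ vs ] w u * 𝟙 (P u) ≡⟨ ∑-cong vs (λ {u} u∈vs →
                                       cong (w u *_) (𝟙-no (λ pu → All.lookup v∉vs u∈vs (sym (uniq pu))))) ⟩
        ∑[ u ∈ vs ] w u * 0       ≡⟨ ∑-cong vs (λ {u} _ → *-zeroʳ (w u)) ⟩
        ∑[ u ∈ vs ] 0             ≡⟨ ∑-const vs 0 ⟩
        length vs * 0             ≡⟨ *-zeroʳ (length vs) ⟩
        0                         ∎
        where open ≡-Reasoning
    ∑-𝟙-single {P} {v ∷ vs} w (v∉vs ∷ !vs) (there k∈vs) pk uniq
      rewrite 𝟙-no (λ pv → All.lookup v∉vs k∈vs (uniq pv)) | *-zeroʳ (w v) =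
      ∑-𝟙-single w !vs k∈vs pk uniq

  module _ {A B : Set} where

    ∑-fibres : ∀ (key : A → B) ts {vs} (w : B → ℕ) → Unique vs → (∀ {t} → t ∈ ts → key t ∈ vs) →
               ∑[ t ∈ ts ] w (key t) ≡ ∑[ v ∈ vs ] w v * count (λ t → key t ≡ v) ts
    ∑-fibres key ts {vs} w !vs key∈vs = begin
      ∑[ t ∈ ts ] w (key t)                          ≡⟨ ∑-cong ts (λ t∈ts →
                                                          sym (∑-𝟙-single w !vs (key∈vs t∈ts) refl sym)) ⟩
      ∑[ t ∈ ts ] ∑[ v ∈ vs ] w v * 𝟙 (key t ≡ v)   ≡⟨ ∑-swap ts vs _ ⟩
      ∑[ v ∈ vs ] ∑[ t ∈ ts ] w v * 𝟙 (key t ≡ v)   ≡⟨ ∑-cong vs (λ {v} _ → ∑-*ˡ ts (w v) _) ⟩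
      ∑[ v ∈ vs ] w v * count (λ t → key t ≡ v) ts ∎
      where open ≡-Reasoning

    length≡∑count : ∀ (R : A → B → Set) ts {vs} → Unique vs →
                    (∀ {t} → t ∈ ts → ∃[ k ] (k ∈ vs × R t k × ∀ {v} → R t v → v ≡ k)) →
                    length ts ≡ ∑[ v ∈ vs ] count (λ t → R t v) ts
    length≡∑count R ts {vs} !vs unique-class = begin
      length ts                                  ≡⟨ sym (∑-1 ts) ⟩
      ∑[ t ∈ ts ] 1                              ≡⟨ ∑-cong ts (λ t∈ts → let k , k∈vs , rk , uniq = unique-class t∈ts in
                                                      sym (∑-𝟙-single (λ _ → 1) !vs k∈vs rk uniq)) ⟩
      ∑[ t ∈ ts ] ∑[ v ∈ vs ] 1 * 𝟙 (R t v)     ≡⟨ ∑-swap ts vs _ ⟩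
      ∑[ v ∈ vs ] ∑[ t ∈ ts ] 1 * 𝟙 (R t v)     ≡⟨ ∑-cong vs (λ _ → ∑-cong ts (λ _ → *-identityˡ _)) ⟩
      ∑[ v ∈ vs ] count (λ t → R t v) ts         ∎
      where open ≡-Reasoning

  module _ {U : Set} where

    length-mono-⊆ : ∀ {xs ys : List U} → Unique xs → xs ListSubset.⊆ ys → length xs ≤ length ys
    length-mono-⊆ {[]}     _            _      = z≤n
    length-mono-⊆ {x ∷ xs} {ys} (x∉xs ∷ !xs) xs⊆ys = begin-strict
      length xs                   ≤⟨ length-mono-⊆ !xs (λ u∈xs →
                                       ∈-filterᶜ⁺ (x ≢_) (xs⊆ys (there u∈xs)) (All.lookup x∉xs u∈xs)) ⟩
      length (filterᶜ (x ≢_) ys)  ≡⟨ length-filterᶜ (x ≢_) ys ⟩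
      count (x ≢_) ys             <⟨ count<length (x ≢_) (xs⊆ys (here refl)) (λ x≢x → x≢x refl) ⟩
      length ys                   ∎
      where open ≤-Reasoning

    HasCard-mono : ∀ {S T : Pred U 0ℓ} {a b} → S ⊆ T → HasCard S a → HasCard T b → a ≤ b
    HasCard-mono S⊆T (xs , !xs , refl , S≐xs) (ys , _ , refl , T≐ys) =
      length-mono-⊆ !xs (λ {u} u∈xs → to (T≐ys u) (S⊆T (from (S≐xs u) u∈xs)))

    HasCard-unique : ∀ {S : Pred U 0ℓ} {a b} → HasCard S a → HasCard S b → a ≡ b
    HasCard-unique |S|≡a |S|≡b = ≤-antisym (HasCard-mono id |S|≡a |S|≡b) (HasCard-mono id |S|≡b |S|≡a)

    HasCard-resp-≐ : ∀ {S T : Pred U 0ℓ} {n} → S ≐ T → HasCard S n → HasCard T n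
    HasCard-resp-≐ (S⊆T , T⊆S) (xs , !xs , len , S≐xs) =
      xs , !xs , len , λ u → mk⇔ (to (S≐xs u) ∘ T⊆S) (S⊆T ∘ from (S≐xs u))

    HasCard-∩ : ∀ {S : Pred U 0ℓ} xs → Unique xs → (∀ u → S u ⇔ u ∈ xs) →
                ∀ P → HasCard (S ∩ P) (count P xs)
    HasCard-∩ xs !xs S≐xs P =
      filterᶜ P xs , filter⁺ (λ _ → em) !xs , length-filterᶜ P xs ,
      λ u → mk⇔ (λ (su , pu) → ∈-filterᶜ⁺ P (to (S≐xs u) su) pu)
                (λ u∈ → let u∈xs , pu = ∈-filterᶜ⁻ P xs u∈ in from (S≐xs u) u∈xs , pu)

    covered⇒Finite : ∀ {S : Pred U 0ℓ} ys → (∀ {u} → S u → u ∈ ys) → Finite S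
    covered⇒Finite {S} ys S⊆ys = length zs , zs , deduplicate-! (filterᶜ S ys) , refl ,
      λ u → mk⇔ (λ su → ∈-deduplicate⁺ _≟_ (∈-filterᶜ⁺ S (S⊆ys su) su))
                (λ u∈zs → proj₂ (∈-filterᶜ⁻ S ys (∈-deduplicate⁻ _≟_ (filterᶜ S ys) u∈zs)))
      where
      _≟_ : DecidableEquality U
      _ ≟ _ = em
      open UniqueDec _≟_ using (deduplicate-!)
      zs : List U
      zs = deduplicate _≟_ (filterᶜ S ys)

module OrbitCounting (em : ExcludedMiddle 0ℓ) {G : Group 0ℓ 0ℓ} {U : Set} (A : Action G U) where
  open FiniteCounting em
  open Group G using (Carrier; _∙_; ε; _⁻¹; inverseˡ; inverseʳ)
  open Action A

  act-⁻¹-act : ∀ g u → act (g ⁻¹) (act g u) ≡ u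
  act-⁻¹-act g u = trans (sym (act-∙ (g ⁻¹) g u)) (trans (act-cong (inverseˡ g) u) (act-ε u))

  act-act-⁻¹ : ∀ g u → act g (act (g ⁻¹) u) ≡ u
  act-act-⁻¹ g u = trans (sym (act-∙ g (g ⁻¹) u)) (trans (act-cong (inverseʳ g) u) (act-ε u))

  closed⇒InvariantSet : ∀ {P : Pred U 0ℓ} → (∀ g {u} → P u → P (act g u)) → InvariantSet A P
  closed⇒InvariantSet {P} closed g u =
    mk⇔ (λ (s , ps , gs≡u) → subst P gs≡u (closed g ps))
        (λ pu → act (g ⁻¹) u , closed (g ⁻¹) pu , act-act-⁻¹ g u)

  Orbit : U → Pred U 0ℓ
  Orbit p v = ∃[ g ] act g p ≡ v

  Orbit-refl : ∀ {p} → Orbit p p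
  Orbit-refl {p} = ε , act-ε p

  Orbit-sym : ∀ {p q} → Orbit p q → Orbit q p
  Orbit-sym {p} (g , refl) = g ⁻¹ , act-⁻¹-act g p

  Orbit-trans : ∀ {p q v} → Orbit p q → Orbit q v → Orbit p v
  Orbit-trans {p} (g , refl) (h , refl) = h ∙ g , act-∙ h g p

  Orbit-≐ : ∀ {p q} → Orbit p q → Orbit p ≐ Orbit q
  Orbit-≐ p~q = Orbit-trans (Orbit-sym p~q) , Orbit-trans p~q

  FiniteOrbit : Pred U 0ℓ
  FiniteOrbit u = Finite (Orbit u)

  orbitList : U → List U
  orbitList p with em {FiniteOrbit p}
  ... | yes (_ , xs , _) = xs
  ... | no  _            = []

  orbitCard : U → ℕ
  orbitCard p = length (orbitList p)

  orbitList-enumerates : ∀ {p} → FiniteOrbit p →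
                         Unique (orbitList p) × (∀ v → Orbit p v ⇔ v ∈ orbitList p)
  orbitList-enumerates {p} fin with em {FiniteOrbit p}
  ... | yes (_ , xs , !xs , _ , Orbit≐xs) = !xs , Orbit≐xs
  ... | no  ¬fin                          = ⊥-elim (¬fin fin)

  module _ {p} (fin : FiniteOrbit p) where

    orbitList-unique : Unique (orbitList p)
    orbitList-unique = proj₁ (orbitList-enumerates fin)

    ∈-orbitList⁺ : ∀ {v} → Orbit p v → v ∈ orbitList p
    ∈-orbitList⁺ {v} = to (proj₂ (orbitList-enumerates fin) v)

    ∈-orbitList⁻ : ∀ {v} → v ∈ orbitList p → Orbit p v
    ∈-orbitList⁻ {v} = from (proj₂ (orbitList-enumerates fin) v)

    orbitList-HasCard : HasCard (Orbit p) (orbitCard p)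
    orbitList-HasCard = orbitList p , orbitList-unique , refl , proj₂ (orbitList-enumerates fin)

  orbitCount : Pred U 0ℓ → U → ℕ
  orbitCount P p = count P (orbitList p)

  orbitCount-HasCard : ∀ {p} (P : Pred U 0ℓ) → FiniteOrbit p → HasCard (P ∩ Orbit p) (orbitCount P p)
  orbitCount-HasCard P fin = HasCard-resp-≐ (swap , swap)
    (HasCard-∩ _ (orbitList-unique fin) (proj₂ (orbitList-enumerates fin)) P)

  FiniteOrbit-resp : ∀ {p q} → FiniteOrbit p → Orbit p q → FiniteOrbit q
  FiniteOrbit-resp (n , |Orbit|≡n) p~q = n , HasCard-resp-≐ (Orbit-≐ p~q) |Orbit|≡n

  orbitCard-resp : ∀ {p q} → FiniteOrbit p → Orbit p q → orbitCard q ≡ orbitCard p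
  orbitCard-resp fin p~q = HasCard-unique
    (orbitList-HasCard (FiniteOrbit-resp fin p~q)) (HasCard-resp-≐ (Orbit-≐ p~q) (orbitList-HasCard fin))

  orbitCount-resp : ∀ {p q} (P : Pred U 0ℓ) → FiniteOrbit p → Orbit p q → orbitCount P q ≡ orbitCount P p
  orbitCount-resp P fin p~q = HasCard-unique (orbitCount-HasCard P (FiniteOrbit-resp fin p~q))
    (HasCard-resp-≐ (map₂ (proj₁ (Orbit-≐ p~q)) , map₂ (proj₂ (Orbit-≐ p~q)))
                    (orbitCount-HasCard P fin))

module Neumann (em : ExcludedMiddle 0ℓ) {G : Group 0ℓ 0ℓ} {U : Set} (A : Action G U) where
  open FiniteCounting em
  open OrbitCounting em A
  open Group G using (Carrier; _∙_; ε; _⁻¹)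
  open Action A

  Fixes : List U → Pred Carrier 0ℓ
  Fixes S g = ∀ {f} → f ∈ S → act g f ≡ f

  Fixes-ε : ∀ {S} → Fixes S ε
  Fixes-ε {f = f} _ = act-ε f

  Fixes-∙ : ∀ {S g h} → Fixes S g → Fixes S h → Fixes S (g ∙ h)
  Fixes-∙ {g = g} {h} g∈Fix h∈Fix {f} f∈S = trans (act-∙ g h f) (trans (cong (act g) (h∈Fix f∈S)) (g∈Fix f∈S))

  Fixes-⁻¹ : ∀ {S g} → Fixes S g → Fixes S (g ⁻¹)
  Fixes-⁻¹ {g = g} g∈Fix {f} f∈S = trans (cong (act (g ⁻¹)) (sym (g∈Fix f∈S))) (act-⁻¹-act g f)

  transporter : List U → U → U → Carrier
  transporter S f y with em {∃[ k ] (Fixes S k × act k f ≡ y)}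
  ... | yes (k , _) = k
  ... | no  _       = ε

  transporter-fixes : ∀ S f y → Fixes S (transporter S f y)
  transporter-fixes S f y with em {∃[ k ] (Fixes S k × act k f ≡ y)}
  ... | yes (_ , k∈Fix , _) = k∈Fix
  ... | no  _               = Fixes-ε

  transporter-maps : ∀ {S f y k} → Fixes S k → act k f ≡ y → act (transporter S f y) f ≡ y
  transporter-maps {S} {f} {y} k∈Fix kf≡y with em {∃[ k ] (Fixes S k × act k f ≡ y)}
  ... | yes (_ , _ , k′f≡y) = k′f≡y
  ... | no  ¬∃              = ⊥-elim (¬∃ (_ , k∈Fix , kf≡y))

  -- Finitely many cosets r · Fixes S cover G, group elements being compared through the action.
  FiniteIndex : List U → Set
  FiniteIndex S = ∃[ R ] ∀ g → ∃[ r ] (r ∈ R × ∃[ k ] (Fixes S k × ∀ u → act g u ≡ act r (act k u)))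

  Fixes-finiteIndex : ∀ S → (∀ {f} → f ∈ S → FiniteOrbit f) → FiniteIndex S
  Fixes-finiteIndex []      _   = ε ∷ [] , λ g → ε , here refl , g , (λ ()) , λ u → sym (act-ε (act g u))
  Fixes-finiteIndex (f ∷ S) fin with Fixes-finiteIndex S (fin ∘ there)
  ... | R , decompose = R′ , refine
    where
    R′ : List Carrier
    R′ = cartesianProductWith (λ r y → r ∙ transporter S f y) R (orbitList f)
    refine : ∀ g → ∃[ r ] (r ∈ R′ × ∃[ k ] (Fixes (f ∷ S) k × ∀ u → act g u ≡ act r (act k u)))
    refine g with decompose g
    ... | r , r∈R , k , k∈Fix , g≡rk =
      r ∙ t , ∈-cartesianProductWith⁺ _ r∈R (∈-orbitList⁺ (fin (here refl)) (k , refl)) ,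
      t ⁻¹ ∙ k , fixes , g≡rt·t⁻¹k
      where
      t : Carrier
      t = transporter S f (act k f)
      fixes : Fixes (f ∷ S) (t ⁻¹ ∙ k)
      fixes (here refl) = begin
        act (t ⁻¹ ∙ k) f     ≡⟨ act-∙ (t ⁻¹) k f ⟩
        act (t ⁻¹) (act k f) ≡⟨ cong (act (t ⁻¹)) (sym (transporter-maps k∈Fix refl)) ⟩
        act (t ⁻¹) (act t f) ≡⟨ act-⁻¹-act t f ⟩
        f                    ∎
        where open ≡-Reasoning
      fixes (there f′∈S) = Fixes-∙ (Fixes-⁻¹ (transporter-fixes S f _)) k∈Fix f′∈S
      g≡rt·t⁻¹k : ∀ u → act g u ≡ act (r ∙ t) (act (t ⁻¹ ∙ k) u)
      g≡rt·t⁻¹k u = begin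
        act g u                          ≡⟨ g≡rk u ⟩
        act r (act k u)                  ≡⟨ cong (act r) (sym (act-act-⁻¹ t (act k u))) ⟩
        act r (act t (act (t ⁻¹) (act k u))) ≡⟨ cong (act r ∘ act t) (sym (act-∙ (t ⁻¹) k u)) ⟩
        act r (act t (act (t ⁻¹ ∙ k) u)) ≡⟨ sym (act-∙ r t _) ⟩
        act (r ∙ t) (act (t ⁻¹ ∙ k) u)   ∎
        where open ≡-Reasoning

  Escapes : List U → U → Set
  Escapes S f = ∀ ys → ∃[ g ] (Fixes S g × act g f ∉ ys)

  infinite⇒Escapes : ∀ {S f} → FiniteIndex S → ¬ FiniteOrbit f → Escapes S f
  infinite⇒Escapes {S} {f} (R , decompose) infinite ys with em {∃[ g ] (Fixes S g × act g f ∉ ys)}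
  ... | yes escape   = escape
  ... | no  ¬escape = ⊥-elim (infinite (covered⇒Finite (cartesianProductWith act R ys) Orbit⊆))
    where
    Orbit⊆ : ∀ {v} → Orbit f v → v ∈ cartesianProductWith act R ys
    Orbit⊆ (g , refl) with decompose g
    ... | r , r∈R , k , k∈Fix , g≡rk with em {act k f ∈ ys}
    ... | yes kf∈ys = subst (_∈ cartesianProductWith act R ys) (sym (g≡rk f)) (∈-cartesianProductWith⁺ act r∈R kf∈ys)
    ... | no  kf∉ys = ⊥-elim (¬escape (k , k∈Fix , kf∉ys))

  Avoids : Carrier → List U → (U → List Carrier) → Set
  Avoids g fs as = ∀ {f} → f ∈ fs → ∀ {a} → a ∈ as f → act g f ≢ act a f

  shiftedBy : U → Carrier → (U → List Carrier) → U → List Carrier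
  shiftedBy f₀ c as f = as f ++ cartesianProductWith (λ a b → a ∙ (c ⁻¹ ∙ b)) (as f₀) (as f)

  shiftedBy-fixes : ∀ {S f₀ c as} → Fixes S c → (∀ f {a} → a ∈ as f → Fixes S a) →
                    ∀ f {a} → a ∈ shiftedBy f₀ c as f → Fixes S a
  shiftedBy-fixes {f₀ = f₀} {c} {as} c∈Fix fixes f a∈ with ∈-++⁻ (as f) a∈
  ... | inj₁ a∈as = fixes f a∈as
  ... | inj₂ a∈shifted with ∈-cartesianProductWith⁻ _ (as f₀) (as f) a∈shifted
  ...   | a′ , b , a′∈ , b∈ , refl = Fixes-∙ (fixes f₀ a′∈) (Fixes-∙ (Fixes-⁻¹ c∈Fix) (fixes f b∈))

  -- If g hits a translate a f₀, replace it by c a⁻¹ g: it sends f₀ to the escaping point c f₀,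
  -- and a collision at another f would have been a collision of g with a c⁻¹ b ∈ shiftedBy.
  retarget : ∀ {f₀ fs as c g a} → a ∈ as f₀ → act c f₀ ∉ map (λ b → act b f₀) (as f₀) →
             Avoids g fs (shiftedBy f₀ c as) → act g f₀ ≡ act a f₀ → Avoids (c ∙ (a ⁻¹ ∙ g)) (f₀ ∷ fs) as
  retarget {f₀} {fs} {as} {c} {g} {a} a∈ cf₀∉ g-avoids gf₀≡af₀ = avoids
    where
    unfold : ∀ u → act (c ∙ (a ⁻¹ ∙ g)) u ≡ act c (act (a ⁻¹) (act g u))
    unfold u = trans (act-∙ c _ u) (cong (act c) (act-∙ (a ⁻¹) g u))
    avoids : Avoids (c ∙ (a ⁻¹ ∙ g)) (f₀ ∷ fs) as
    avoids (here refl) {b} b∈ hf₀≡bf₀ =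
      cf₀∉ (subst (_∈ map (λ b → act b f₀) (as f₀)) (sym cf₀≡bf₀) (∈-map⁺ _ b∈))
      where
      cf₀≡bf₀ : act c f₀ ≡ act b f₀
      cf₀≡bf₀ = begin
        act c f₀                          ≡⟨ cong (act c) (sym (act-⁻¹-act a f₀)) ⟩
        act c (act (a ⁻¹) (act a f₀))     ≡⟨ cong (act c ∘ act (a ⁻¹)) (sym gf₀≡af₀) ⟩
        act c (act (a ⁻¹) (act g f₀))     ≡⟨ sym (unfold f₀) ⟩
        act (c ∙ (a ⁻¹ ∙ g)) f₀           ≡⟨ hf₀≡bf₀ ⟩
        act b f₀                          ∎
        where open ≡-Reasoning
    avoids {f} (there f∈fs) {b} b∈ hf≡bf =
      g-avoids f∈fs (∈-++⁺ʳ (as f) (∈-cartesianProductWith⁺ _ a∈ b∈)) gf≡acb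
      where
      gf≡acb : act g f ≡ act (a ∙ (c ⁻¹ ∙ b)) f
      gf≡acb = begin
        act g f                                      ≡⟨ sym (act-act-⁻¹ a _) ⟩
        act a (act (a ⁻¹) (act g f))                 ≡⟨ cong (act a) (sym (act-⁻¹-act c _)) ⟩
        act a (act (c ⁻¹) (act c (act (a ⁻¹) (act g f)))) ≡⟨ cong (act a ∘ act (c ⁻¹)) (trans (sym (unfold f)) hf≡bf) ⟩
        act a (act (c ⁻¹) (act b f))                 ≡⟨ cong (act a) (sym (act-∙ (c ⁻¹) b f)) ⟩
        act a (act (c ⁻¹ ∙ b) f)                     ≡⟨ sym (act-∙ a _ f) ⟩
        act (a ∙ (c ⁻¹ ∙ b)) f                       ∎
        where open ≡-Reasoning

  avoidTranslates : ∀ {S} fs (as : U → List Carrier) → (∀ {f} → f ∈ fs → Escapes S f) →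
                    (∀ f {a} → a ∈ as f → Fixes S a) → ∃[ g ] (Fixes S g × Avoids g fs as)
  avoidTranslates []        as _       _     = ε , Fixes-ε , λ ()
  avoidTranslates (f₀ ∷ fs) as escapes fixes
    with escapes (here refl) (map (λ a → act a f₀) (as f₀))
  ... | c , c∈Fix , cf₀∉
    with avoidTranslates fs (shiftedBy f₀ c as) (escapes ∘ there) (shiftedBy-fixes c∈Fix fixes)
  ... | g , g∈Fix , g-avoids with em {∃[ a ] (a ∈ as f₀ × act g f₀ ≡ act a f₀)}
  ... | no ¬hit = g , g∈Fix , λ where
          (here refl) a∈ gf₀≡af₀ → ¬hit (_ , a∈ , gf₀≡af₀)
          (there f∈fs) a∈         → g-avoids f∈fs (∈-++⁺ˡ a∈)
  ... | yes (a , a∈ , gf₀≡af₀) =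
    c ∙ (a ⁻¹ ∙ g) , Fixes-∙ c∈Fix (Fixes-∙ (Fixes-⁻¹ (fixes f₀ a∈)) g∈Fix) ,
    retarget a∈ cf₀∉ g-avoids gf₀≡af₀

  neumann : ∀ {S} fs → (∀ {f} → f ∈ fs → Escapes S f) → ∀ ys →
            ∃[ g ] (Fixes S g × ∀ {f} → f ∈ fs → act g f ∉ ys)
  neumann {S} fs escapes ys with avoidTranslates fs (λ f → map (transporter S f) ys) escapes transporters-fix
    where
    transporters-fix : ∀ f {a} → a ∈ map (transporter S f) ys → Fixes S a
    transporters-fix f a∈ with ∈-map⁻ (transporter S f) a∈
    ... | y , _ , refl = transporter-fixes S f y
  ... | g , g∈Fix , g-avoids =
    g , g∈Fix , λ f∈fs gf∈ys → g-avoids f∈fs (∈-map⁺ _ gf∈ys) (sym (transporter-maps g∈Fix refl))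

  module _ {I : Set} {F : I → Pred U 0ℓ} (invF : InvariantFamily A F) (finF : ∀ i → Finite (F i)) where

    finiteOrbitPart-IsSR : ∀ {X k} → HasCard X k → IsSR F X → IsSR F (X ∩ FiniteOrbit)
    finiteOrbitPart-IsSR {X} (xs , _ , _ , X≐xs) srX i with em {∃[ u ] ((X ∩ FiniteOrbit) u × F i u)}
    ... | yes hit  = hit
    ... | no  ¬hit with finF i
    ...   | _ , fsᵢ , _ , _ , Fᵢ≐fsᵢ = ⊥-elim contradiction
      where
      S fs : List U
      S  = filterᶜ FiniteOrbit fsᵢ
      fs = filterᶜ (¬_ ∘ FiniteOrbit) fsᵢ
      escapes : ∀ {f} → f ∈ fs → Escapes S f
      escapes f∈fs = infinite⇒Escapes (Fixes-finiteIndex S (proj₂ ∘ ∈-filterᶜ⁻ _ fsᵢ))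
                                      (proj₂ (∈-filterᶜ⁻ _ fsᵢ f∈fs))
      contradiction : ⊥
      contradiction with neumann fs escapes xs
      ... | g , g∈Fix , g-escapes with invF g i
      ... | j , Fⱼ≐gFᵢ with srX j
      ... | u , xu , fⱼu with to (Fⱼ≐gFᵢ u) fⱼu
      ... | s , fᵢs , gs≡u with to (Fᵢ≐fsᵢ s) fᵢs | em {FiniteOrbit s}
      ... | s∈fsᵢ | yes fin =
        ¬hit (s , (subst X (trans (sym gs≡u) (g∈Fix (∈-filterᶜ⁺ _ s∈fsᵢ fin))) xu , fin) , fᵢs)
      ... | s∈fsᵢ | no  inf = g-escapes (∈-filterᶜ⁺ _ s∈fsᵢ inf) (subst (_∈ xs) (sym gs≡u) (to (X≐xs u) xu))

    minimalSR⊆FiniteOrbit : ∀ {X k} → IsSR F X → HasCard X k →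
                            (∀ (X′ : Pred U 0ℓ) (k′ : ℕ) → IsSR F X′ → HasCard X′ k′ → k ≤ k′) →
                            ∀ {x} → X x → FiniteOrbit x
    minimalSR⊆FiniteOrbit srX |X|≡k@(xs , !xs , refl , X≐xs) minimal {x} xx with em {FiniteOrbit x}
    ... | yes fin = fin
    ... | no  inf = ⊥-elim (<⇒≱ (count<length FiniteOrbit (to (X≐xs x) xx) inf)
                      (minimal _ _ (finiteOrbitPart-IsSR |X|≡k srX) (HasCard-∩ xs !xs X≐xs FiniteOrbit)))

module TupleTranslates (em : ExcludedMiddle 0ℓ) {G : Group 0ℓ 0ℓ} {U : Set} (A : Action G U) where
  open FiniteCounting em
  open OrbitCounting em A
  open Group G using (Carrier; _∙_; ε; _⁻¹)
  open Action A

  translate : ∀ {r} → Carrier → Vec U r → Vec U r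
  translate g = Vec.map (act g)

  translate-⁻¹ : ∀ {r} g (t : Vec U r) → translate (g ⁻¹) (translate g t) ≡ t
  translate-⁻¹ g t = begin
    translate (g ⁻¹) (translate g t) ≡⟨ sym (map-∘ (act (g ⁻¹)) (act g) t) ⟩
    Vec.map (act (g ⁻¹) ∘ act g) t   ≡⟨ map-cong (act-⁻¹-act g) t ⟩
    Vec.map id t                     ≡⟨ map-id t ⟩
    t                                ∎
    where open ≡-Reasoning

  translate-injective : ∀ {r} g {t t′ : Vec U r} → translate g t ≡ translate g t′ → t ≡ t′
  translate-injective g {t} {t′} eq =
    trans (sym (translate-⁻¹ g t)) (trans (cong (translate (g ⁻¹)) eq) (translate-⁻¹ g t′))

  orbitProduct : ∀ {r} → Vec U r → List (Vec U r)
  orbitProduct []       = [] ∷ []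
  orbitProduct (p ∷ ps) = cartesianProductWith _∷_ (orbitList p) (orbitProduct ps)

  translate∈orbitProduct : ∀ {r} (ps : Vec U r) → (∀ q → FiniteOrbit (lookup ps q)) →
                           ∀ g → translate g ps ∈ orbitProduct ps
  translate∈orbitProduct []       _   g = here refl
  translate∈orbitProduct (p ∷ ps) fin g =
    ∈-cartesianProductWith⁺ _∷_ (∈-orbitList⁺ (fin Fin.zero) (g , refl)) (translate∈orbitProduct ps (fin ∘ Fin.suc) g)

  module Translates {r} (ps : Vec U r) (fin : ∀ q → FiniteOrbit (lookup ps q)) where

    IsTranslate : Pred (Vec U r) 0ℓ
    IsTranslate t = ∃[ g ] translate g ps ≡ t

    private
      |translates| : Finite IsTranslate
      |translates| = covered⇒Finite (orbitProduct ps) λ where (g , refl) → translate∈orbitProduct ps fin g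

    translates : List (Vec U r)
    translates = proj₁ (proj₂ |translates|)

    translates-unique : Unique translates
    translates-unique = proj₁ (proj₂ (proj₂ |translates|))

    IsTranslate≐translates : ∀ t → IsTranslate t ⇔ t ∈ translates
    IsTranslate≐translates = proj₂ (proj₂ (proj₂ (proj₂ |translates|)))

    translate∈translates : ∀ g → translate g ps ∈ translates
    translate∈translates g = to (IsTranslate≐translates _) (g , refl)

    translates-closed : ∀ h {t} → t ∈ translates → translate h t ∈ translates
    translates-closed h {t} t∈ with from (IsTranslate≐translates t) t∈
    ... | g , refl = subst (_∈ translates) (trans (map-cong (act-∙ h g) ps) (map-∘ (act h) (act g) ps))
                           (translate∈translates (h ∙ g))

    T : ℕ
    T = length translates

    1≤T : 1 ≤ T
    1≤T = ∈⇒1≤length (translate∈translates ε)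

    fibre : Fin r → U → ℕ
    fibre q v = count (λ t → lookup t q ≡ v) translates

    -- Translating by h maps the fibre over v injectively into the fibre over h v.
    fibre-mono : ∀ q v h → fibre q v ≤ fibre q (act h v)
    fibre-mono q v h = begin
      fibre q v                              ≡⟨ sym (length-filterᶜ _ translates) ⟩
      length Fibre                           ≡⟨ sym (length-map (translate h) Fibre) ⟩
      length (List.map (translate h) Fibre)  ≤⟨ length-mono-⊆ !h·Fibre h·Fibre⊆ ⟩
      length (filterᶜ _ translates)          ≡⟨ length-filterᶜ _ translates ⟩
      fibre q (act h v)                      ∎
      where
      open ≤-Reasoning
      Fibre : List (Vec U r)
      Fibre = filterᶜ (λ t → lookup t q ≡ v) translates
      !h·Fibre : Unique (List.map (translate h) Fibre)
      !h·Fibre = map⁺ (translate-injective h) (filter⁺ (λ _ → em) translates-unique)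
      h·Fibre⊆ : List.map (translate h) Fibre ListSubset.⊆ filterᶜ (λ t → lookup t q ≡ act h v) translates
      h·Fibre⊆ ht∈ with ∈-map⁻ (translate h) ht∈
      ... | t , t∈Fibre , refl with ∈-filterᶜ⁻ _ translates t∈Fibre
      ...   | t∈ , refl = ∈-filterᶜ⁺ _ (translates-closed h t∈) (lookup-map q (act h) t)

    φ : Fin r → ℕ
    φ q = fibre q (lookup ps q)

    fibre-Orbit : ∀ q {v} → Orbit (lookup ps q) v → fibre q v ≡ φ q
    fibre-Orbit q (h , refl) = ≤-antisym
      (subst (fibre q (act h p) ≤_) (cong (fibre q) (act-⁻¹-act h p)) (fibre-mono q _ (h ⁻¹)))
      (fibre-mono q p h)
      where
      p : U
      p = lookup ps q

    coordinate∈orbitList : ∀ q {t} → t ∈ translates → lookup t q ∈ orbitList (lookup ps q)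
    coordinate∈orbitList q t∈ with from (IsTranslate≐translates _) t∈
    ... | g , refl = ∈-orbitList⁺ (fin q) (g , sym (lookup-map q (act g) ps))

    ∑-coordinate : ∀ q (w : U → ℕ) →
                   ∑[ t ∈ translates ] w (lookup t q) ≡ ∑ (orbitList (lookup ps q)) w * φ q
    ∑-coordinate q w = begin
      ∑[ t ∈ translates ] w (lookup t q) ≡⟨ ∑-fibres (λ t → lookup t q) translates w
                                              (orbitList-unique (fin q)) (coordinate∈orbitList q) ⟩
      ∑[ v ∈ vs ] w v * fibre q v         ≡⟨ ∑-cong vs (λ {v} v∈ →
                                              cong (w v *_) (fibre-Orbit q (∈-orbitList⁻ (fin q) v∈))) ⟩
      ∑[ v ∈ vs ] w v * φ q               ≡⟨ ∑-*ʳ vs w (φ q) ⟩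
      ∑ vs w * φ q                        ∎
      where
      open ≡-Reasoning
      vs : List U
      vs = orbitList (lookup ps q)

    T≡orbitCard*φ : ∀ q → T ≡ orbitCard (lookup ps q) * φ q
    T≡orbitCard*φ q = begin
      T                              ≡⟨ sym (∑-1 translates) ⟩
      ∑[ t ∈ translates ] 1          ≡⟨ ∑-coordinate q (λ _ → 1) ⟩
      (∑[ v ∈ vs ] 1) * φ q          ≡⟨ cong (_* φ q) (∑-1 vs) ⟩
      orbitCard (lookup ps q) * φ q  ∎
      where
      open ≡-Reasoning
      vs : List U
      vs = orbitList (lookup ps q)

    T≤∑count : ∀ (X : Pred U 0ℓ) → (∀ g → ∃[ q ] X (act g (lookup ps q))) →
               T ≤ ∑[ q ∈ allFin r ] count (λ t → X (lookup t q)) translates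
    T≤∑count X meets = begin
      T                                                             ≡⟨ sym (∑-1 translates) ⟩
      ∑[ t ∈ translates ] 1                                         ≤⟨ ∑-mono-≤ translates 1≤hits ⟩
      ∑[ t ∈ translates ] count (λ q → X (lookup t q)) (allFin r)   ≡⟨ ∑-swap translates (allFin r) _ ⟩
      ∑[ q ∈ allFin r ] count (λ t → X (lookup t q)) translates     ∎
      where
      open ≤-Reasoning
      1≤hits : ∀ {t} → t ∈ translates → 1 ≤ count (λ q → X (lookup t q)) (allFin r)
      1≤hits t∈ with from (IsTranslate≐translates _) t∈
      ... | g , refl with meets g
      ...   | q , xq = 1≤count _ (∈-allFin q) (subst X (sym (lookup-map q (act g) ps)) xq)

    T≤∑orbitCount*φ : ∀ (X : Pred U 0ℓ) → (∀ g → ∃[ q ] X (act g (lookup ps q))) →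
                      T ≤ ∑[ q ∈ allFin r ] orbitCount X (lookup ps q) * φ q
    T≤∑orbitCount*φ X meets =
      subst (T ≤_) (∑-cong (allFin r) (λ {q} _ → ∑-coordinate q (λ v → 𝟙 (X v)))) (T≤∑count X meets)


module MemberBounds (em : ExcludedMiddle 0ℓ) {G : Group 0ℓ 0ℓ} {U : Set} (A : Action G U)
  {I : Set} {F : I → Pred U 0ℓ} (invF : InvariantFamily A F) (finF : ∀ i → Finite (F i))
  {X : Pred U 0ℓ} (srX : IsSR F X)
  {W : Pred U 0ℓ} (W-closed : ∀ g {u} → W u → W (Action.act A g u)) (X⊆W : X ⊆ W)
  (W⊆FiniteOrbit : W ⊆ OrbitCounting.FiniteOrbit em A)
  {m : ℕ} (|F|≤m : ∀ i k → HasCard (F i) k → k ≤ m) (i : I) where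

  open FiniteCounting em
  open OrbitCounting em A
  open TupleTranslates em A
  open Group G using (_⁻¹)
  open Action A

  private
    fsᵢ : List U
    fsᵢ = proj₁ (proj₂ (finF i))

    Fᵢ≐fsᵢ : ∀ u → F i u ⇔ u ∈ fsᵢ
    Fᵢ≐fsᵢ = proj₂ (proj₂ (proj₂ (proj₂ (finF i))))

    Pᵢ : List U
    Pᵢ = filterᶜ W fsᵢ

    r : ℕ
    r = length Pᵢ

    |fsᵢ|≤m : length fsᵢ ≤ m
    |fsᵢ|≤m = |F|≤m i _ (fsᵢ , proj₁ (proj₂ (proj₂ (finF i))) , refl , Fᵢ≐fsᵢ)

    r≤m : r ≤ m
    r≤m = begin
      length Pᵢ        ≡⟨ length-filterᶜ W fsᵢ ⟩
      count W fsᵢ      ≤⟨ count≤length W fsᵢ ⟩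
      length fsᵢ       ≤⟨ |fsᵢ|≤m ⟩
      m                ∎
      where open ≤-Reasoning

    W-back : ∀ g {s} → W (act g s) → W s
    W-back g {s} w = subst W (act-⁻¹-act g s) (W-closed (g ⁻¹) w)

    ps : Vec U r
    ps = Vec.tabulate (List.lookup Pᵢ)

    ps∈Pᵢ : ∀ q → lookup ps q ∈ Pᵢ
    ps∈Pᵢ q = subst (_∈ Pᵢ) (sym (lookup∘tabulate _ q)) (∈-lookup q)

    ps-finite : ∀ q → FiniteOrbit (lookup ps q)
    ps-finite q = W⊆FiniteOrbit (proj₂ (∈-filterᶜ⁻ W fsᵢ (ps∈Pᵢ q)))

    ∈Pᵢ⇒ps : ∀ {s} → s ∈ Pᵢ → ∃[ q ] lookup ps q ≡ s
    ∈Pᵢ⇒ps s∈ = Any.index s∈ , trans (lookup∘tabulate _ (Any.index s∈)) (sym (lookup-index s∈))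

    -- g⁻¹ maps the point of X on the member gFᵢ back to a point of Fᵢ ∩ W.
    translates-meet-X : ∀ g → ∃[ q ] X (act g (lookup ps q))
    translates-meet-X g with invF g i
    ... | j , Fⱼ≐gFᵢ with srX j
    ... | u , xu , fⱼu with to (Fⱼ≐gFᵢ u) fⱼu
    ... | s , fᵢs , refl with ∈Pᵢ⇒ps (∈-filterᶜ⁺ W (to (Fᵢ≐fsᵢ s) fᵢs) (W-back g (X⊆W xu)))
    ... | q , refl = q , xu

    open Translates ps ps-finite
    open WeightedCounts {c = orbitCard ∘ lookup ps} {a = orbitCount X ∘ lookup ps} {φ = φ}
                        1≤T (sym ∘ T≡orbitCard*φ) (T≤∑orbitCount*φ X translates-meet-X)

  ∃small-orbit : ∃[ u ] ((F i ∩ W) u × orbitCard u ≤ m * orbitCount X u)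
  ∃small-orbit with ∃c≤m*a r≤m
  ... | q , small with ∈-filterᶜ⁻ W fsᵢ (ps∈Pᵢ q)
  ...   | ps∈fsᵢ , w = lookup ps q , (from (Fᵢ≐fsᵢ _) ps∈fsᵢ , w) , small

  tight⇒F⊆W : (∀ {u} → W u → orbitCard u ≡ m * orbitCount X u) → F i ⊆ W
  tight⇒F⊆W tight fᵢu = length≤count⇒∈⇒P W fsᵢ (≤-trans |fsᵢ|≤m m≤r′) (to (Fᵢ≐fsᵢ _) fᵢu)
    where
    m≤r′ : m ≤ count W fsᵢ
    m≤r′ = subst (m ≤_) (length-filterᶜ W fsᵢ) (m≤r (λ q → tight (proj₂ (∈-filterᶜ⁻ W fsᵢ (ps∈Pᵢ q)))))

module OrbitsOfMinimalSR (em : ExcludedMiddle 0ℓ) {G : Group 0ℓ 0ℓ} {U : Set} (A : Action G U)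
  {I : Set} {F : I → Pred U 0ℓ} (invF : InvariantFamily A F) (finF : ∀ i → Finite (F i))
  {X : Pred U 0ℓ} {k : ℕ} (srX : IsSR F X) (|X|≡k : HasCard X k)
  (minX : ∀ (X′ : Pred U 0ℓ) (k′ : ℕ) → IsSR F X′ → HasCard X′ k′ → k ≤ k′)
  {n : ℕ} {V : Fin n → Pred U 0ℓ} (orbV : ∀ j → IsOrbit A (V j))
  (meetV : ∀ j → ∃[ u ] (X u × V j u)) (coverX : ∀ u → X u → ∃[ j ] V j u)
  (disjV : ∀ j j′ u → V j u → V j′ u → j ≡ j′) where

  open FiniteCounting em
  open OrbitCounting em A
  open Neumann em A
  open Action A

  rep : Fin n → U
  rep j = proj₁ (orbV j)

  V⊆Orbit : ∀ j → V j ⊆ Orbit (rep j)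
  V⊆Orbit j {w} = to (proj₂ (orbV j) w)

  Orbit⊆V : ∀ j → Orbit (rep j) ⊆ V j
  Orbit⊆V j {w} = from (proj₂ (orbV j) w)

  V-closed : ∀ j g {u} → V j u → V j (act g u)
  V-closed j g vu = Orbit⊆V j (Orbit-trans (V⊆Orbit j vu) (g , refl))

  X⊆FiniteOrbit : X ⊆ FiniteOrbit
  X⊆FiniteOrbit = minimalSR⊆FiniteOrbit invF finF srX |X|≡k minX

  rep-finite : ∀ j → FiniteOrbit (rep j)
  rep-finite j with meetV j
  ... | x , xx , vx = FiniteOrbit-resp (X⊆FiniteOrbit xx) (Orbit-sym (V⊆Orbit j vx))

  c : Fin n → ℕ
  c j = orbitCard (rep j)

  a : Fin n → ℕ
  a j = orbitCount X (rep j)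

  V-HasCard : ∀ j → HasCard (V j) (c j)
  V-HasCard j = HasCard-resp-≐ (Orbit⊆V j , V⊆Orbit j) (orbitList-HasCard (rep-finite j))

  X∩V-HasCard : ∀ j → HasCard (X ∩ V j) (a j)
  X∩V-HasCard j = HasCard-resp-≐ (map₂ (Orbit⊆V j) , map₂ (V⊆Orbit j)) (orbitCount-HasCard X (rep-finite j))

  orbitCard-V : ∀ j {u} → V j u → orbitCard u ≡ c j
  orbitCard-V j vu = orbitCard-resp (rep-finite j) (V⊆Orbit j vu)

  orbitCount-V : ∀ j {u} → V j u → orbitCount X u ≡ a j
  orbitCount-V j vu = orbitCount-resp X (rep-finite j) (V⊆Orbit j vu)

  1≤c : ∀ j → 1 ≤ c j
  1≤c j = ∈⇒1≤length (∈-orbitList⁺ (rep-finite j) Orbit-refl)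

  1≤a : ∀ j → 1 ≤ a j
  1≤a j with meetV j
  ... | x , xx , vx = 1≤count X (∈-orbitList⁺ (rep-finite j) (V⊆Orbit j vx)) xx

  Union : Pred (Fin n) 0ℓ → Pred U 0ℓ
  Union J u = ∃[ j ] (J j × V j u)

  Union-invariant : ∀ J → InvariantSet A (Union J)
  Union-invariant J = closed⇒InvariantSet λ g (j , jJ , vu) → j , jJ , V-closed j g vu

  one-orbit-each : ∀ {S : Pred U 0ℓ} → S ⊆ (λ u → ∃[ j ] V j u) → ∀ {u} → S u →
                   ∃[ j ] (j ∈ allFin n × V j u × ∀ {j′} → V j′ u → j′ ≡ j)
  one-orbit-each S⊆ su with S⊆ su
  ... | j , vu = j , ∈-allFin j , vu , λ v′u → disjV _ j _ v′u vu

  HasCard-∑V : ∀ {S : Pred U 0ℓ} {N} → S ⊆ (λ u → ∃[ j ] V j u) → HasCard S N →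
               ∀ {s : Fin n → ℕ} → (∀ j → HasCard (S ∩ V j) (s j)) → N ≡ ∑[ j ∈ allFin n ] s j
  HasCard-∑V {S} S⊆ (zs , !zs , refl , S≐zs) {s} |S∩V|≡s = begin
    length zs                               ≡⟨ length≡∑count (λ z j → V j z) zs (allFin⁺ n)
                                                 (one-orbit-each S⊆ ∘ from (S≐zs _)) ⟩
    ∑[ j ∈ allFin n ] count (V j) zs        ≡⟨ ∑-cong (allFin n) (λ {j} _ →
                                                 HasCard-unique (HasCard-∩ zs !zs S≐zs (V j)) (|S∩V|≡s j)) ⟩
    ∑[ j ∈ allFin n ] s j                   ∎
    where open ≡-Reasoning

  Union∩V-HasCard : ∀ J j → HasCard (Union J ∩ V j) (𝟙 (J j) * c j)
  Union∩V-HasCard J j with em {J j}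
  ... | yes jJ = HasCard-resp-≐ ((λ vu → (j , jJ , vu) , vu) , proj₂)
                   (subst (HasCard (V j)) (sym (+-identityʳ (c j))) (V-HasCard j))
  ... | no ¬jJ = [] , [] , refl , λ u → mk⇔
                   (λ ((j′ , j′J , vj′u) , vju) → ⊥-elim (¬jJ (subst J (disjV j′ j u vj′u vju) j′J))) λ ()

  Union-HasCard : ∀ J → HasCard (Union J) (∑[ j ∈ allFin n ] 𝟙 (J j) * c j)
  Union-HasCard J =
    let _ , |Union|≡N = covered⇒Finite (concatMap (orbitList ∘ rep) (allFin n)) Union⊆
    in  subst (HasCard (Union J)) (HasCard-∑V (λ (j , _ , vu) → j , vu) |Union|≡N (Union∩V-HasCard J)) |Union|≡N
    where
    Union⊆ : ∀ {u} → Union J u → u ∈ concatMap (orbitList ∘ rep) (allFin n)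
    Union⊆ (j , _ , vu) =
      ∈-concatMap⁺ (orbitList ∘ rep) (lose (∈-allFin j) (∈-orbitList⁺ (rep-finite j) (V⊆Orbit j vu)))

  ∑a≡k : ∑[ j ∈ allFin n ] a j ≡ k
  ∑a≡k = sym (HasCard-∑V (λ {u} → coverX u) |X|≡k X∩V-HasCard)

  V-finite : ∀ j → Finite (V j)
  V-finite j = c j , V-HasCard j

  Covered : Pred U 0ℓ
  Covered u = ∃[ j ] V j u

  module _ {m : ℕ} (maxm : IsMaxCard F m)
    (minY : ∀ (Y′ : Pred U 0ℓ) (k′ : ℕ) → InvariantSet A Y′ → IsSR F Y′ → HasCard Y′ k′ → k * m ≤ k′) where

    private
      module Member = MemberBounds em A invF finF srX (λ g (j , vu) → j , V-closed j g vu) (coverX _)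
        (λ (j , vu) → FiniteOrbit-resp (rep-finite j) (V⊆Orbit j vu)) (proj₂ maxm)

    1≤m : 1 ≤ m
    1≤m with proj₁ maxm
    ... | i₀ , fs , _ , |fs|≡m , Fᵢ₀≐fs with srX i₀
    ...   | u , _ , fᵢ₀u = subst (1 ≤_) |fs|≡m (∈⇒1≤length (to (Fᵢ₀≐fs u) fᵢ₀u))

    k*m≤|Union| : ∀ J → IsSR F (Union J) → k * m ≤ ∑[ j ∈ allFin n ] 𝟙 (J j) * c j
    k*m≤|Union| J sr = minY (Union J) _ (Union-invariant J) sr (Union-HasCard J)

    ∑m*a≡k*m : ∑[ j ∈ allFin n ] m * a j ≡ k * m
    ∑m*a≡k*m = trans (∑-*ˡ (allFin n) m a) (trans (cong (m *_) ∑a≡k) (*-comm m k))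

    SmallOrbit : Pred (Fin n) 0ℓ
    SmallOrbit j = c j ≤ m * a j

    SmallOrbits-SR : IsSR F (Union SmallOrbit)
    SmallOrbits-SR i =
      let u , (fᵢu , j , vu) , small = Member.∃small-orbit i
      in  u , (j , subst₂ _≤_ (orbitCard-V j vu) (cong (m *_) (orbitCount-V j vu)) small , vu) , fᵢu

    𝟙*c≤m*a : ∀ j → 𝟙 (SmallOrbit j) * c j ≤ m * a j
    𝟙*c≤m*a j with em {SmallOrbit j}
    ... | yes small = subst (_≤ m * a j) (sym (+-identityʳ (c j))) small
    ... | no  _     = z≤n

    -- The invariant system ⋃{Vⱼ : cⱼ ≤ m aⱼ} has at least k m = Σⱼ m aⱼ points, so no orbit is dropped.
    c≡m*a : ∀ j → c j ≡ m * a j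
    c≡m*a j = 𝟙*x≡y⇒x≡y (*-mono-≤ 1≤m (1≤a j))
      (∑-tight (allFin n) (λ {j} _ → 𝟙*c≤m*a j)
               (≤-trans (≤-reflexive ∑m*a≡k*m) (k*m≤|Union| SmallOrbit SmallOrbits-SR)) (∈-allFin j))

    |V|≡m*|X∩V| : ∀ j c′ a′ → HasCard (V j) c′ → HasCard (X ∩ V j) a′ → c′ ≡ m * a′
    |V|≡m*|X∩V| j c′ a′ |V|≡c′ |X∩V|≡a′ =
      trans (HasCard-unique |V|≡c′ (V-HasCard j))
            (trans (c≡m*a j) (cong (m *_) (HasCard-unique (X∩V-HasCard j) |X∩V|≡a′)))

    member⊆Covered : ∀ i u → F i u → Covered u
    member⊆Covered i u = Member.tight⇒F⊆W i λ (j , vu) →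
      trans (orbitCard-V j vu) (trans (c≡m*a j) (cong (m *_) (sym (orbitCount-V j vu))))

    Others-SR : ∀ j → ¬ (∃[ i ] (F i ⊆ V j)) → IsSR F (Union (_≢ j))
    Others-SR j none i with em {∃[ u ] (F i u × ¬ V j u)}
    ... | no  ¬escape =
      ⊥-elim (none (i , λ {u} fᵢu → decidable-stable em (λ ¬vu → ¬escape (u , fᵢu , ¬vu))))
    ... | yes (u , fᵢu , ¬vju) =
      let j′ , vj′u = member⊆Covered i u fᵢu in u , (j′ , (λ { refl → ¬vju vj′u }) , vj′u) , fᵢu

    -- Dropping Vⱼ would leave an invariant system of representatives with Σⱼ′ cⱼ′ − cⱼ < k m points.
    no-member⊆V⇒c≡0 : ∀ j → ¬ (∃[ i ] (F i ⊆ V j)) → c j ≡ 0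
    no-member⊆V⇒c≡0 j none = trans (sym (𝟙*c≡c (∈-allFin j))) (cong (_* c j) (𝟙-no λ j≢j → j≢j refl))
      where
      𝟙*c≤c : ∀ {j′} → j′ ∈ allFin n → 𝟙 (j′ ≢ j) * c j′ ≤ c j′
      𝟙*c≤c {j′} _ = ≤-trans (*-monoˡ-≤ (c j′) (𝟙≤1 (j′ ≢ j))) (≤-reflexive (*-identityˡ (c j′)))
      ∑c≤|Others| : ∑ (allFin n) c ≤ ∑[ j′ ∈ allFin n ] 𝟙 (j′ ≢ j) * c j′
      ∑c≤|Others| = ≤-trans (≤-reflexive (trans (∑-cong (allFin n) (λ {j′} _ → c≡m*a j′)) ∑m*a≡k*m))
                            (k*m≤|Union| (_≢ j) (Others-SR j none))
      𝟙*c≡c : ∀ {j′} → j′ ∈ allFin n → 𝟙 (j′ ≢ j) * c j′ ≡ c j′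
      𝟙*c≡c = ∑-tight (allFin n) 𝟙*c≤c ∑c≤|Others|

    ∃member⊆V : ∀ j → ∃[ i ] (F i ⊆ V j)
    ∃member⊆V j = decidable-stable em λ none → <⇒≢ (1≤c j) (sym (no-member⊆V⇒c≡0 j none))

-- The bound B on the sizes of the members is implied by IsMaxCard F m wherever it matters, and
-- of Y only the resulting lower bound k m on invariant systems of representatives is used.
corollary1p2 : ExcludedMiddle 0ℓ →
  (G : Group 0ℓ 0ℓ) (U : Set) (A : Action G U)
  (I : Set) (F : I → Pred U 0ℓ) →
  InvariantFamily A F →
  (∀ i → Finite (F i)) →
  (∃[ B ] (∀ i k → HasCard (F i) k → k ≤ B)) →
  (X : Pred U 0ℓ) (k : ℕ) → IsSR F X → HasCard X k →
  (∀ (X′ : Pred U 0ℓ) (k′ : ℕ) → IsSR F X′ → HasCard X′ k′ → k ≤ k′) →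
  (n : ℕ) (V : Fin n → Pred U 0ℓ) →
  (∀ j → IsOrbit A (V j)) →
  (∀ j → ∃[ u ] (X u × V j u)) →
  (∀ u → X u → ∃[ j ] V j u) →
  (∀ j j′ u → V j u → V j′ u → j ≡ j′) →
  (∀ j → Finite (V j))
  × (∀ (m : ℕ) → IsMaxCard F m →
     ∀ (Y : Pred U 0ℓ) → InvariantSet A Y → IsSR F Y →
     (∀ (Y′ : Pred U 0ℓ) (k′ : ℕ) → InvariantSet A Y′ → IsSR F Y′ → HasCard Y′ k′ → k * m ≤ k′) →
     HasCard Y (k * m) →
       (∀ j c a → HasCard (V j) c → HasCard (X ∩ V j) a → c ≡ m * a)
       × (∀ i u → F i u → ∃[ j ] V j u)
       × (∀ j → ∃[ i ] (F i ⊆ V j)))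
corollary1p2 em G U A I F invF finF _ X k srX |X|≡k minX n V orbV meetV coverX disjV =
  V-finite , λ m maxm _ _ _ minY _ → |V|≡m*|X∩V| maxm minY , member⊆Covered maxm minY , ∃member⊆V maxm minY
  where open OrbitsOfMinimalSR em A invF finF srX |X|≡k minX orbV meetV coverX disjV
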